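{- Let $n, k$ be positive integers. There exists an algorithm in the adjustable-threshold adaptive model that, for every $x\in\{0,1\}^n$, determines $MAJ_n(x)$ using at most $\lceil n/k\rceil \lceil \log_2(k+1)\rceil$ queries to the oracle.
   Context: For $x\in\{0,1\}^n$, $MAJ_n(x) = [x_1+\cdots+x_n \ge n/2]$, where $[P]=1$ if $P$ holds and $0$ otherwise. For $S\subseteq\{1,\ldots,n\}$ let $sum_S(x)=\sum_{i\in S}x_i$ and $MAJ_S(x;t) = [sum_S(x)\ge t]$. In the adjustable-threshold adaptive model an algorithm has access to an oracle that knows the hidden vector $x$; a query is a pair $(S,t)$ with $S\subseteq\{1,\ldots,n\}$, $|S|\le k$ and $t$ an integer, and the oracle answers $MAJ_S(x;t)$. -}

module Defs where

open import Data.Bool using (Bool; true; false; _∧_; if_then_else_)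
open import Data.Nat using (ℕ; zero; suc; _+_; _*_; _≤_; _≤ᵇ_)
open import Data.Nat.DivMod using (_/_)
open import Data.Nat.Logarithm using (⌈log₂_⌉)
open import Data.Integer using (ℤ; +_) renaming (_≤ᵇ_ to _≤ᵇℤ_)
open import Data.Fin using (Fin)
open import Data.Fin.Subset using (Subset; ∣_∣)
open import Data.Vec using (Vec; []; _∷_)

sumS : ∀ {n} → Subset n → Vec Bool n → ℕ
sumS [] [] = 0
sumS (true ∷ S) (true ∷ x) = suc (sumS S x)
sumS (_ ∷ S) (_ ∷ x) = sumS S x

sumAll : ∀ {n} → Vec Bool n → ℕ
sumAll [] = 0
sumAll (true ∷ x) = suc (sumAll x)
sumAll (false ∷ x) = sumAll x

-- MAJ_n(x) = [sum(x) ≥ n/2]  ⇔  [n ≤ 2 * sum(x)]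
MAJ : ∀ {n} → Vec Bool n → Bool
MAJ {n} x = n ≤ᵇ 2 * sumAll x

MAJS : ∀ {n} → Subset n → ℤ → Vec Bool n → Bool
MAJS S t x = t ≤ᵇℤ (+ sumS S x)

-- Adaptive algorithms in the adjustable-threshold model, as decision trees:
-- either output a bit, or query (S, t) with |S| ≤ k and continue
-- depending on the oracle's answer.
data Alg (n k : ℕ) : Set where
  output : Bool → Alg n k
  query  : (S : Subset n) → ∣ S ∣ ≤ k → (t : ℤ) → (Bool → Alg n k) → Alg n k

run : ∀ {n k} → Alg n k → Vec Bool n → Bool
run (output b) x = b
run (query S _ t next) x = run (next (MAJS S t x)) x

queries : ∀ {n k} → Alg n k → Vec Bool n → ℕ
queries (output b) x = 0
queries (query S _ t next) x = suc (queries (next (MAJS S t x)) x)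

-- ⌈ n / k ⌉ (for k ≥ 1)
ceilDiv : ℕ → ℕ → ℕ
ceilDiv n zero = 0
ceilDiv n (suc k) = (n + k) / suc k

module Submission where

-- Cut the positions 0 … n-1 into B = ⌈n/k⌉ consecutive windows of k positions
-- (the last one may run past n and then contains fewer positions).  The number
-- s of ones inside a window W satisfies 0 ≤ s ≤ |W| ≤ k < 2^L for
-- L = ⌈log₂(k+1)⌉, so L threshold queries (W, t) determine s by binary search.
-- The window counts add up to sum(x), and MAJ(x) = [n ≤ 2·sum(x)].

open import Defs
open import Data.Bool using (Bool; true; false; if_then_else_)
open import Data.Nat using (ℕ; zero; suc; _*_; _+_; _≤_; _<_; _^_; _≤ᵇ_; z≤n; s≤s; s≤s⁻¹; ⌊_/2⌋; ⌈_/2⌉)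
open import Data.Nat.Properties
open import Data.Nat.DivMod using (_/_; _%_; m≡m%n+[m/n]*n; m%n<n)
open import Data.Nat.Induction using (<-wellFounded)
open import Data.Nat.Logarithm using (⌈log₂_⌉)
open import Data.Nat.Logarithm.Core using (⌈log2⌉)
open import Data.Integer using (+_)
open import Data.Fin.Subset using (Subset; ∣_∣)
open import Data.Vec using (Vec; []; _∷_)
open import Data.Product using (Σ; _×_; _,_; proj₁; proj₂; map₂)
open import Induction.WellFounded using (Acc; acc)
open import Relation.Nullary.Reflects using (ofʸ; ofⁿ)
open import Relation.Binary.PropositionalEquality using (_≡_; refl; sym; trans; cong; module ≡-Reasoning)

-- m ≤ 2^⌈log₂ m⌉, by well-founded induction along the recursion defining
-- ⌈log₂⌉: for m ≥ 2, m ≤ 2·⌈m/2⌉ and ⌈log₂ m⌉ = 1 + ⌈log₂ ⌈m/2⌉⌉.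
m≤2^⌈log2⌉m : ∀ m (rec : Acc _<_ m) → m ≤ 2 ^ ⌈log2⌉ m rec
m≤2^⌈log2⌉m zero _ = z≤n
m≤2^⌈log2⌉m (suc zero) _ = s≤s z≤n
m≤2^⌈log2⌉m m@(suc (suc _)) (acc rs) = begin
  m                          ≡⟨ ⌊n/2⌋+⌈n/2⌉≡n m ⟨
  ⌊ m /2⌋ + h                ≤⟨ +-monoˡ-≤ h (⌊n/2⌋≤⌈n/2⌉ m) ⟩
  h + h                      ≡⟨ cong (λ t → h + t) (+-identityʳ h) ⟨
  2 * h                      ≤⟨ *-monoʳ-≤ 2 (m≤2^⌈log2⌉m h (rs _)) ⟩
  2 * 2 ^ ⌈log2⌉ h (rs _)    ∎
  where
  open ≤-Reasoning
  h : ℕ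
  h = ⌈ m /2⌉

k<2^⌈log₂[k+1]⌉ : ∀ k → k < 2 ^ ⌈log₂ (k + 1) ⌉
k<2^⌈log₂[k+1]⌉ k =
  ≤-trans (≤-reflexive (+-comm 1 k)) (m≤2^⌈log2⌉m (k + 1) (<-wellFounded (k + 1)))

n≤ceilDiv*k : ∀ n k → n ≤ ceilDiv n (suc k) * suc k
n≤ceilDiv*k n k = +-cancelˡ-≤ k n (q * suc k) (begin
  k + n                      ≡⟨ +-comm k n ⟩
  n + k                      ≡⟨ m≡m%n+[m/n]*n (n + k) (suc k) ⟩
  (n + k) % suc k + q * suc k ≤⟨ +-monoˡ-≤ (q * suc k) (s≤s⁻¹ (m%n<n (n + k) (suc k))) ⟩
  k + q * suc k              ∎)
  where
  open ≤-Reasoning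
  q : ℕ
  q = ceilDiv n (suc k)

-- 2^(d+1) = 2^d + 2^d, in the form used to halve a search interval.
+2^suc : ∀ a d → a + 2 ^ suc d ≡ a + 2 ^ d + 2 ^ d
+2^suc a d = trans (cong (λ e → a + (2 ^ d + e)) (+-identityʳ (2 ^ d))) (sym (+-assoc a (2 ^ d) (2 ^ d)))

window : (a w n : ℕ) → Subset n
window _ _ zero = []
window (suc a) w (suc n) = false ∷ window a w n
window zero (suc w) (suc n) = true ∷ window zero w n
window zero zero (suc n) = false ∷ window zero zero n

∣window∣≤width : ∀ a w n → ∣ window a w n ∣ ≤ w
∣window∣≤width _ _ zero = z≤n
∣window∣≤width (suc a) w (suc n) = ∣window∣≤width a w n
∣window∣≤width zero (suc w) (suc n) = s≤s (∣window∣≤width zero w n)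
∣window∣≤width zero zero (suc n) = ∣window∣≤width zero zero n

sumS≤∣S∣ : ∀ {n} (S : Subset n) (x : Vec Bool n) → sumS S x ≤ ∣ S ∣
sumS≤∣S∣ [] [] = z≤n
sumS≤∣S∣ (true ∷ S) (true ∷ x) = s≤s (sumS≤∣S∣ S x)
sumS≤∣S∣ (true ∷ S) (false ∷ x) = m≤n⇒m≤1+n (sumS≤∣S∣ S x)
sumS≤∣S∣ (false ∷ S) (_ ∷ x) = sumS≤∣S∣ S x

sum-emptyWindow : ∀ a n (x : Vec Bool n) → sumS (window a 0 n) x ≡ 0
sum-emptyWindow _ zero [] = refl
sum-emptyWindow (suc a) (suc n) (_ ∷ x) = sum-emptyWindow a n x
sum-emptyWindow zero (suc n) (_ ∷ x) = sum-emptyWindow zero n x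

sum-window-+ : ∀ a v w n (x : Vec Bool n) →
  sumS (window a (v + w) n) x ≡ sumS (window a v n) x + sumS (window (a + v) w n) x
sum-window-+ _ _ _ zero [] = refl
sum-window-+ (suc a) v w (suc n) (_ ∷ x) = sum-window-+ a v w n x
sum-window-+ zero (suc v) w (suc n) (true ∷ x) = cong suc (sum-window-+ zero v w n x)
sum-window-+ zero (suc v) w (suc n) (false ∷ x) = sum-window-+ zero v w n x
sum-window-+ zero zero w (suc n) x =
  cong (_+ sumS (window zero w (suc n)) x) (sym (sum-emptyWindow zero (suc n) x))

sum-fullWindow : ∀ w n (x : Vec Bool n) → n ≤ w → sumS (window 0 w n) x ≡ sumAll x
sum-fullWindow _ zero [] _ = refl
sum-fullWindow (suc w) (suc n) (true ∷ x) (s≤s n≤w) = cong suc (sum-fullWindow w n x n≤w)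
sum-fullWindow (suc w) (suc n) (false ∷ x) (s≤s n≤w) = sum-fullWindow w n x n≤w

-- A learner asks some queries and hands a number to the rest of the algorithm.
Learner : ℕ → ℕ → Set
Learner n k = (ℕ → Alg n k) → Alg n k

Learns : ∀ {n k} → Learner n k → Vec Bool n → ℕ → ℕ → Set
Learns P x v d = ∀ c → (run (P c) x ≡ run (c v) x) × (queries (P c) x ≡ d + queries (c v) x)

learns-now : ∀ {n k} (x : Vec Bool n) v → Learns {n} {k} (λ c → c v) x v 0
learns-now x v c = refl , refl

learns-cong : ∀ {n k} {P : Learner n k} {x u v d} → u ≡ v → Learns P x u d → Learns P x v d
learns-cong refl learns = learns

_then+_ : ∀ {n k} → Learner n k → (ℕ → Learner n k) → Learner n k
(P then+ Q) c = P (λ s → Q s (λ t → c (s + t)))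

learns-then+ : ∀ {n k} {P : Learner n k} {Q : ℕ → Learner n k} {x u w d e} →
  Learns P x u d → Learns (Q u) x w e → Learns (P then+ Q) x (u + w) (d + e)
learns-then+ {n} {k} {P} {Q} {x} {u} {w} {d} {e} learnsP learnsQ c = trans runP runQ , (begin
  queries ((P then+ Q) c) x                   ≡⟨ costP ⟩
  d + queries (Q u restAfterP) x              ≡⟨ cong (λ t → d + t) costQ ⟩
  d + (e + queries (c (u + w)) x)             ≡⟨ +-assoc d e _ ⟨
  d + e + queries (c (u + w)) x               ∎)
  where
  open ≡-Reasoning
  restAfterP : ℕ → Alg n k
  restAfterP t = c (u + t)
  runP : run ((P then+ Q) c) x ≡ run (Q u restAfterP) x
  runP = proj₁ (learnsP (λ s → Q s (λ t → c (s + t))))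
  costP : queries ((P then+ Q) c) x ≡ d + queries (Q u restAfterP) x
  costP = proj₂ (learnsP (λ s → Q s (λ t → c (s + t))))
  runQ : run (Q u restAfterP) x ≡ run (c (u + w)) x
  runQ = proj₁ (learnsQ restAfterP)
  costQ : queries (Q u restAfterP) x ≡ e + queries (c (u + w)) x
  costQ = proj₂ (learnsQ restAfterP)

module BinarySearch {n k : ℕ} (S : Subset n) (S-legal : ∣ S ∣ ≤ k) where

  binarySearch : (d lo : ℕ) → Learner n k
  binarySearch zero lo c = c lo
  binarySearch (suc d) lo c = query S S-legal (+ (lo + 2 ^ d)) λ reached →
    if reached then binarySearch d (lo + 2 ^ d) c else binarySearch d lo c

  binarySearch-learns : ∀ d lo x → lo ≤ sumS S x → sumS S x < lo + 2 ^ d →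
    Learns (binarySearch d lo) x (sumS S x) d
  binarySearch-learns zero lo x lo≤s s<lo+1 =
    learns-cong (≤-antisym lo≤s (m<1+n⇒m≤n (<-≤-trans s<lo+1 (≤-reflexive (+-comm lo 1)))))
      (learns-now x lo)
  binarySearch-learns (suc d) lo x lo≤s s<hi c
    with lo + 2 ^ d ≤ᵇ sumS S x | ≤ᵇ-reflects-≤ (lo + 2 ^ d) (sumS S x)
  ... | true  | ofʸ mid≤s = map₂ (cong suc)
    (binarySearch-learns d (lo + 2 ^ d) x mid≤s (<-≤-trans s<hi (≤-reflexive (+2^suc lo d))) c)
  ... | false | ofⁿ mid≰s = map₂ (cong suc) (binarySearch-learns d lo x lo≤s (≰⇒> mid≰s) c)

module WindowCounting (n k : ℕ) where

  L : ℕ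
  L = ⌈log₂ (k + 1) ⌉

  countWindow : ℕ → Learner n k
  countWindow a = binarySearch L 0
    where open BinarySearch (window a k n) (∣window∣≤width a k n)

  countWindow-learns : ∀ a x → Learns (countWindow a) x (sumS (window a k n) x) L
  countWindow-learns a x = binarySearch-learns L 0 x z≤n
      (≤-<-trans (≤-trans (sumS≤∣S∣ (window a k n) x) (∣window∣≤width a k n)) (k<2^⌈log₂[k+1]⌉ k))
    where open BinarySearch (window a k n) (∣window∣≤width a k n)

  countWindows : ℕ → ℕ → Learner n k
  countWindows zero a c = c 0
  countWindows (suc j) a = countWindow a then+ λ _ → countWindows j (a + k)

  countWindows-learns : ∀ j a x → Learns (countWindows j a) x (sumS (window a (j * k) n) x) (j * L)
  countWindows-learns zero a x = learns-cong (sym (sum-emptyWindow a n x)) (learns-now x 0)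
  countWindows-learns (suc j) a x = learns-cong (sym (sum-window-+ a k (j * k) n x))
    (learns-then+ (countWindow-learns a x) (countWindows-learns j (a + k) x))

mainTheorem3 : (n k : ℕ) → 1 ≤ n → 1 ≤ k →
    Σ (Alg n k) (λ A → (x : Vec Bool n) →
    (run A x ≡ MAJ x) × (queries A x ≤ ceilDiv n k * ⌈log₂ (k + 1) ⌉))
mainTheorem3 n zero _ ()
mainTheorem3 n (suc k) _ _ = majority , λ x →
    let runs , cost = countWindows-learns blocks 0 x decide in
    trans runs (cong (λ s → n ≤ᵇ 2 * s) (sum-fullWindow (blocks * suc k) n x (n≤ceilDiv*k n k))) ,
    ≤-reflexive (trans cost (+-identityʳ (blocks * L)))
  where
  open WindowCounting n (suc k)
  blocks : ℕ
  blocks = ceilDiv n (suc k)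
  decide : ℕ → Alg n (suc k)
  decide s = output (n ≤ᵇ 2 * s)
  majority : Alg n (suc k)
  majority = countWindows blocks 0 decide
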